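{- Let $k>0$ be an integer and $q\in[0,1]$, and let $m<M_{k,q}$. Then $$\Pr\left[X_{n,m}(k)<h^{ -1}\cdot\mathbb{E}[X_{n,m}(k)]\right]\leq2q,$$ where $h=h(n)$ is any quantity with $h(n)>2\,\mathbb{E}[X_{n,M_{k,q}}(k)]$.
   Context: $G^*(n,m)$ is the random graph on $n$ vertices obtained by inserting $m$ edges, each choosing its two endpoints uniformly at random with replacement (independently), then deleting self-loops and replacing multiple edges by a single edge. $X_{n,m}(k)=|\mathcal{S}_k(G^*(n,m))|$ is the number of independent sets of size $k$ in $G^*(n,m)$, and $M_{k,q}=\max\{m\in\mathbb{N}:\Pr[X_{n,m}(k)>0]\geq1-q\}$.
   Formalization: The parameter q ranges over the rational numbers in $[0,1]$, and the quantity h is rational. -}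

module Defs where

open import Data.Bool using (Bool; true; false; _∧_; _∨_; not; if_then_else_)
open import Data.Nat using (ℕ; zero; suc; _+_; _*_; _^_; NonZero; _≡ᵇ_)
open import Data.Nat.Properties using (m^n≢0; m*n≢0)
open import Data.Fin using (Fin; _≟_)
open import Data.Fin.Subset using (Subset; _∈_; ∣_∣)
open import Data.Fin.Subset.Properties using (_∈?_)
open import Data.Product using (_×_; _,_)
open import Data.List using (List; []; _∷_; map; concatMap; length; allFin; cartesianProduct)
open import Data.Nat.ListAction using (sum)
open import Data.Vec using (Vec; []; _∷_; toList)
open import Data.Integer using (+_)
open import Data.Rational using (ℚ; _/_; _<_)
import Data.Rational
import Data.Nat
import Data.Rational.Properties as ℚP
open import Relation.Nullary using (does; ¬?)
open import Relation.Unary using (Decidable)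

allVecs : {A : Set} → List A → (m : ℕ) → List (Vec A m)
allVecs xs zero    = [] ∷ []
allVecs xs (suc m) = concatMap (λ x → map (x ∷_) (allVecs xs m)) xs

allSubsets : (n : ℕ) → List (Subset n)
allSubsets n = allVecs (true ∷ false ∷ []) n

-- An outcome of the random experiment G*(n,m): the sequence of m edges,
-- each an ordered pair of endpoints chosen uniformly and independently
-- (with replacement).
Outcome : ℕ → ℕ → Set
Outcome n m = Vec (Fin n × Fin n) m

outcomes : (n m : ℕ) → List (Outcome n m)
outcomes n m = allVecs (cartesianProduct (allFin n) (allFin n)) m

size : ℕ → ℕ → ℕ
size n m = (n * n) ^ m

-- Adjacency in G*(n,m) for outcome ω: u ≠ v and some inserted edge
-- has endpoints {u,v} (self-loops deleted, multi-edges merged).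
sameFin : {n : ℕ} → Fin n → Fin n → Bool
sameFin u v = does (u ≟ v)

isEdge : {n : ℕ} → Fin n → Fin n → (Fin n × Fin n) → Bool
isEdge u v (a , b) = (sameFin u a ∧ sameFin v b) ∨ (sameFin u b ∧ sameFin v a)

anyEdge : {n m : ℕ} → Fin n → Fin n → Outcome n m → Bool
anyEdge u v []       = false
anyEdge u v (e ∷ es) = isEdge u v e ∨ anyEdge u v es

adj : {n m : ℕ} → Outcome n m → Fin n → Fin n → Bool
adj ω u v = not (sameFin u v) ∧ anyEdge u v ω

countB : {A : Set} → (A → Bool) → List A → ℕ
countB p []       = 0
countB p (x ∷ xs) = if p x then suc (countB p xs) else countB p xs

allL : {A : Set} → (A → Bool) → List A → Bool
allL p []       = true
allL p (x ∷ xs) = p x ∧ allL p xs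

independent : {n m : ℕ} → Outcome n m → Subset n → Bool
independent {n} ω S =
  allL (λ u → allL (λ v → not (does (u ∈? S) ∧ does (v ∈? S) ∧ adj ω u v)) (allFin n)) (allFin n)

X : {n m : ℕ} → ℕ → Outcome n m → ℕ
X {n} k ω = countB (λ S → (∣ S ∣ ≡ᵇ k) ∧ independent ω S) (allSubsets n)

Pr : (n m : ℕ) .{{_ : NonZero n}} → (Outcome n m → Bool) → ℚ
Pr n m {{nz}} P = (+ countB P (outcomes n m)) / size n m
  where instance _ = m*n≢0 n n
                 _ = m^n≢0 (n * n) m

E : (n m : ℕ) .{{_ : NonZero n}} → ℕ → ℚ
E n m k = (+ sum (map (X k) (outcomes n m))) / size n m
  where instance _ = m*n≢0 n n
                 _ = m^n≢0 (n * n) m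

PrPos : (n m : ℕ) .{{_ : NonZero n}} → ℕ → ℚ
PrPos n m k = Pr n m (λ ω → not (X k ω ≡ᵇ 0))

IsM : (n : ℕ) .{{_ : NonZero n}} → ℕ → ℚ → ℕ → Set
IsM n k q M = (Data.Rational._≤_ (Data.Rational.1ℚ Data.Rational.- q) (PrPos n M k))
            × ((m : ℕ) → Data.Rational._≤_ (Data.Rational.1ℚ Data.Rational.- q) (PrPos n m k) → Data.Nat._≤_ m M)

-- Pr[ X_{n,m}(k) < h^{-1} E[X_{n,m}(k)] ], with the event written as h·X < E (h > 0).
PrBelow : (n m : ℕ) .{{_ : NonZero n}} → ℕ → ℚ → ℚ
PrBelow n m k h = Pr n m (λ ω → does (Data.Rational._*_ h ((+ X k ω) / 1) ℚP.<? E n m k))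

module Submission where

-- Write M = d + m.  An outcome of G*(n,M) is a pair (ω₂, ω₁) of outcomes of
-- G*(n,d) and G*(n,m), and S is independent in it iff it is independent in both
-- parts.  One edge keeps a fixed k-set independent for exactly ρ = n² − k(k−1) of
-- its n² = N values, so summing over ω₂ gives the extension identity
--   ∑_{ω₂} X(ω₂ ω₁) = X(ω₁)·ρ^d,   hence E_M = E_m·(ρ/N)^d.
-- If ω₁ is below (h·X(ω₁) < E_m) then 2·E_M < h forces X(ω₁)ρ^d < N^d/2, so by
-- Markov fewer than half of its extensions have X > 0.  Averaging over ω₁,
--   2·#{X_M > 0} + N^d·#below ≤ 2·N^d·N^m,
-- and Pr[X_M > 0] ≥ 1 − q turns this into Pr[below] ≤ 2q.

open import Defs
open import Algebra.Bundles using (CommutativeMonoid)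
open import Data.Bool using (Bool; true; false; _∧_; _∨_; not; T)
open import Data.Bool.Properties using (∧-commutativeMonoid; ∧-assoc; ∧-zeroʳ; ∧-identityʳ; not-involutive; T-∨)
open import Data.Empty using (⊥-elim)
open import Data.Fin using (Fin; zero; suc; _≟_)
open import Data.Fin.Subset using (Subset; ∣_∣)
open import Data.Fin.Subset.Properties using (_∈?_)
open import Data.List using (List; []; _∷_; map; concatMap; length; allFin; cartesianProduct; _++_)
open import Data.List.Membership.Propositional using (_∈_)
open import Data.List.Membership.Propositional.Properties using (∈-allFin)
open import Data.List.Properties using (length-tabulate; map-tabulate)
open import Data.List.Relation.Unary.Any using (here; there)
import Data.Integer as ℤ
import Data.Integer.Properties as ℤP
open import Data.Nat using (ℕ; zero; suc; pred; _+_; _*_; _^_; _∸_; _≤_; _<_; z≤n; s≤s; _≡ᵇ_; NonZero; >-nonZero⁻¹)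
open import Data.Nat.ListAction using (sum)
open import Data.Nat.Properties hiding (_≟_)
open import Data.Rational as ℚ using (ℚ; _/_; 0ℚ; 1ℚ)
import Data.Rational.Properties as ℚP
open import Data.Rational.Solver renaming (module +-*-Solver to ℚ-Solver)
open import Data.Nat.Solver using (module +-*-Solver)
open import Data.Rational.Unnormalised as ℚᵘ using (mkℚᵘ; *<*; *≤*)
import Data.Rational.Unnormalised.Properties as ℚᵘP
open import Data.Product using (_×_; _,_)
open import Data.Sum using (inj₁; inj₂)
open import Data.Vec using (Vec; []; _∷_) renaming (_++_ to _++ᵛ_)
open import Function using (_∘_; Equivalence)
open import Relation.Nullary using (Dec; yes; no; does; ¬_)
open import Relation.Nullary.Decidable using (dec-true)
open import Relation.Binary.PropositionalEquality
open import Algebra.Properties.CommutativeSemigroup +-commutativeSemigroup using (x∙yz≈y∙xz) renaming (interchange to +-interchange)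
open import Algebra.Properties.CommutativeSemigroup (CommutativeMonoid.commutativeSemigroup ∧-commutativeMonoid)
  using () renaming (interchange to ∧-interchange)

𝟙 : Bool → ℕ
𝟙 true  = 1
𝟙 false = 0

𝟙-∧ : ∀ a b → 𝟙 (a ∧ b) ≡ 𝟙 a * 𝟙 b
𝟙-∧ true  b = sym (+-identityʳ (𝟙 b))
𝟙-∧ false b = refl

𝟙-not : ∀ x → 𝟙 x + 𝟙 (not x) ≡ 1
𝟙-not true  = refl
𝟙-not false = refl

does⇒ : {A : Set} (d : Dec A) → T (does d) → A
does⇒ (yes p) _ = p

∑ : {A : Set} → (A → ℕ) → List A → ℕ
∑ f []       = 0
∑ f (x ∷ xs) = f x + ∑ f xs

module _ {A : Set} where

  countB-∑ : (p : A → Bool) (xs : List A) → countB p xs ≡ ∑ (𝟙 ∘ p) xs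
  countB-∑ p []       = refl
  countB-∑ p (x ∷ xs) with p x
  ... | true  = cong suc (countB-∑ p xs)
  ... | false = countB-∑ p xs

  sum-map-∑ : (f : A → ℕ) (xs : List A) → sum (map f xs) ≡ ∑ f xs
  sum-map-∑ f []       = refl
  sum-map-∑ f (x ∷ xs) = cong (f x +_) (sum-map-∑ f xs)

  ∑-cong : {f g : A → ℕ} → (∀ x → f x ≡ g x) → (xs : List A) → ∑ f xs ≡ ∑ g xs
  ∑-cong f≗g []       = refl
  ∑-cong f≗g (x ∷ xs) = cong₂ _+_ (f≗g x) (∑-cong f≗g xs)

  ∑-mono : {f g : A → ℕ} → (∀ x → f x ≤ g x) → (xs : List A) → ∑ f xs ≤ ∑ g xs
  ∑-mono f≤g []       = z≤n
  ∑-mono f≤g (x ∷ xs) = +-mono-≤ (f≤g x) (∑-mono f≤g xs)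

  ∑-++ : (f : A → ℕ) (xs ys : List A) → ∑ f (xs ++ ys) ≡ ∑ f xs + ∑ f ys
  ∑-++ f []       ys = refl
  ∑-++ f (x ∷ xs) ys = trans (cong (f x +_) (∑-++ f xs ys)) (sym (+-assoc (f x) _ _))

  ∑-+ : (f g : A → ℕ) (xs : List A) → ∑ (λ x → f x + g x) xs ≡ ∑ f xs + ∑ g xs
  ∑-+ f g []       = refl
  ∑-+ f g (x ∷ xs) = trans (cong (f x + g x +_) (∑-+ f g xs)) (+-interchange (f x) (g x) (∑ f xs) (∑ g xs))

  ∑-*ˡ : (c : ℕ) (f : A → ℕ) (xs : List A) → ∑ (λ x → c * f x) xs ≡ c * ∑ f xs
  ∑-*ˡ c f []       = sym (*-zeroʳ c)
  ∑-*ˡ c f (x ∷ xs) = trans (cong (c * f x +_) (∑-*ˡ c f xs)) (sym (*-distribˡ-+ c (f x) (∑ f xs)))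

  ∑-*ʳ : (c : ℕ) (f : A → ℕ) (xs : List A) → ∑ (λ x → f x * c) xs ≡ ∑ f xs * c
  ∑-*ʳ c f xs = trans (∑-cong (λ x → *-comm (f x) c) xs) (trans (∑-*ˡ c f xs) (*-comm c (∑ f xs)))

  ∑-const : (c : ℕ) (xs : List A) → ∑ (λ _ → c) xs ≡ length xs * c
  ∑-const c []       = refl
  ∑-const c (x ∷ xs) = cong (c +_) (∑-const c xs)

∑-map : {A B : Set} (f : B → ℕ) (g : A → B) (xs : List A) → ∑ f (map g xs) ≡ ∑ (f ∘ g) xs
∑-map f g []       = refl
∑-map f g (x ∷ xs) = cong (f (g x) +_) (∑-map f g xs)

module _ {A B : Set} where

  ∑-concatMap : (f : B → ℕ) (g : A → List B) (xs : List A) →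
                ∑ f (concatMap g xs) ≡ ∑ (λ x → ∑ f (g x)) xs
  ∑-concatMap f g []       = refl
  ∑-concatMap f g (x ∷ xs) = trans (∑-++ f (g x) (concatMap g xs)) (cong (∑ f (g x) +_) (∑-concatMap f g xs))

  ∑-swap : (f : A → B → ℕ) (xs : List A) (ys : List B) →
           ∑ (λ x → ∑ (f x) ys) xs ≡ ∑ (λ y → ∑ (λ x → f x y) xs) ys
  ∑-swap f []       ys = sym (trans (∑-const 0 ys) (*-zeroʳ (length ys)))
  ∑-swap f (x ∷ xs) ys = trans (cong (∑ (f x) ys +_) (∑-swap f xs ys))
                               (sym (∑-+ (f x) (λ y → ∑ (λ x′ → f x′ y) xs) ys))

  ∑-cartesianProduct : (g : A × B → ℕ) (xs : List A) (ys : List B) →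
                       ∑ g (cartesianProduct xs ys) ≡ ∑ (λ x → ∑ (λ y → g (x , y)) ys) xs
  ∑-cartesianProduct g []       ys = refl
  ∑-cartesianProduct g (x ∷ xs) ys =
    trans (∑-++ g (map (x ,_) ys) _) (cong₂ _+_ (∑-map g (x ,_) ys) (∑-cartesianProduct g xs ys))

∑-allFin-suc : {n : ℕ} (f : Fin (suc n) → ℕ) → ∑ f (allFin (suc n)) ≡ f zero + ∑ (f ∘ suc) (allFin n)
∑-allFin-suc {n} f = cong (f zero +_) (trans (cong (∑ f) (sym (map-tabulate (λ i → i) suc))) (∑-map f suc (allFin n)))

∑-allFin-1 : (n : ℕ) → ∑ (λ _ → 1) (allFin n) ≡ n
∑-allFin-1 n = trans (∑-const 1 (allFin n)) (trans (*-identityʳ _) (length-tabulate {n = n} (λ i → i)))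

averaging : {A : Set} (D : ℕ) (c : A → ℕ) (marked : A → Bool) →
            (∀ x → c x ≤ D) → (∀ x → T (marked x) → 2 * c x < D) → (xs : List A) →
            2 * ∑ c xs + D * ∑ (𝟙 ∘ marked) xs ≤ length xs * (2 * D)
averaging D c marked c≤D small xs = begin
  2 * ∑ c xs + D * ∑ (𝟙 ∘ marked) xs                       ≡⟨ cong₂ _+_ (∑-*ˡ 2 c xs) (∑-*ˡ D (𝟙 ∘ marked) xs) ⟨
  ∑ (λ x → 2 * c x) xs + ∑ (λ x → D * 𝟙 (marked x)) xs     ≡⟨ ∑-+ _ _ xs ⟨
  ∑ (λ x → 2 * c x + D * 𝟙 (marked x)) xs                  ≤⟨ ∑-mono each xs ⟩
  ∑ (λ _ → 2 * D) xs                                       ≡⟨ ∑-const (2 * D) xs ⟩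
  length xs * (2 * D)                                      ∎
  where
  open ≤-Reasoning
  each : ∀ x → 2 * c x + D * 𝟙 (marked x) ≤ 2 * D
  each x with marked x in eq
  ... | true  = begin
    2 * c x + D * 1   ≡⟨ cong (2 * c x +_) (*-identityʳ D) ⟩
    2 * c x + D       ≤⟨ +-monoˡ-≤ D (<⇒≤ (small x (subst T (sym eq) _))) ⟩
    D + D             ≡⟨ cong (D +_) (+-identityʳ D) ⟨
    2 * D             ∎
  ... | false = begin
    2 * c x + D * 0   ≡⟨ cong (2 * c x +_) (*-zeroʳ D) ⟩
    2 * c x + 0       ≡⟨ +-identityʳ _ ⟩
    2 * c x           ≤⟨ *-monoʳ-≤ 2 (c≤D x) ⟩
    2 * D             ∎

∑-allVecs-++ : {A : Set} (L : List A) (d m : ℕ) (f : Vec A (d + m) → ℕ) →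
               ∑ f (allVecs L (d + m)) ≡ ∑ (λ ω₂ → ∑ (λ ω₁ → f (ω₂ ++ᵛ ω₁)) (allVecs L m)) (allVecs L d)
∑-allVecs-++ L zero    m f = sym (+-identityʳ _)
∑-allVecs-++ L (suc d) m f = begin
  ∑ f (concatMap (λ x → map (x ∷_) (allVecs L (d + m))) L)
    ≡⟨ ∑-concatMap f _ L ⟩
  ∑ (λ x → ∑ f (map (x ∷_) (allVecs L (d + m)))) L
    ≡⟨ ∑-cong (λ x → trans (∑-map f (x ∷_) (allVecs L (d + m))) (∑-allVecs-++ L d m (f ∘ (x ∷_)))) L ⟩
  ∑ (λ x → ∑ (λ ω₂ → ∑ (λ ω₁ → f (x ∷ (ω₂ ++ᵛ ω₁))) (allVecs L m)) (allVecs L d)) L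
    ≡⟨ ∑-cong (λ x → ∑-map _ (x ∷_) (allVecs L d)) L ⟨
  ∑ (λ x → ∑ (λ ω₂ → ∑ (λ ω₁ → f (ω₂ ++ᵛ ω₁)) (allVecs L m)) (map (x ∷_) (allVecs L d))) L
    ≡⟨ ∑-concatMap _ _ L ⟨
  ∑ (λ ω₂ → ∑ (λ ω₁ → f (ω₂ ++ᵛ ω₁)) (allVecs L m)) (allVecs L (suc d)) ∎
  where open ≡-Reasoning

∑-allVecs-product : {A : Set} (L : List A) (g : A → ℕ) (w : ∀ {d} → Vec A d → ℕ) →
                    w [] ≡ 1 → (∀ {d} x (ω : Vec A d) → w (x ∷ ω) ≡ g x * w ω) →
                    ∀ d → ∑ w (allVecs L d) ≡ ∑ g L ^ d
∑-allVecs-product L g w w[] w∷ zero    = cong (_+ 0) w[]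
∑-allVecs-product L g w w[] w∷ (suc d) = begin
  ∑ w (concatMap (λ x → map (x ∷_) (allVecs L d)) L)    ≡⟨ ∑-concatMap w _ L ⟩
  ∑ (λ x → ∑ w (map (x ∷_) (allVecs L d))) L             ≡⟨ ∑-cong (λ x → ∑-map w (x ∷_) (allVecs L d)) L ⟩
  ∑ (λ x → ∑ (λ ω → w (x ∷ ω)) (allVecs L d)) L          ≡⟨ ∑-cong (λ x → ∑-cong (w∷ x) (allVecs L d)) L ⟩
  ∑ (λ x → ∑ (λ ω → g x * w ω) (allVecs L d)) L          ≡⟨ ∑-cong (λ x → ∑-*ˡ (g x) w (allVecs L d)) L ⟩
  ∑ (λ x → g x * ∑ w (allVecs L d)) L                    ≡⟨ ∑-*ʳ _ g L ⟩
  ∑ g L * ∑ w (allVecs L d)                              ≡⟨ cong (∑ g L *_) (∑-allVecs-product L g w w[] w∷ d) ⟩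
  ∑ g L * ∑ g L ^ d                                      ∎
  where open ≡-Reasoning

pairs : (n : ℕ) → List (Fin n × Fin n)
pairs n = cartesianProduct (allFin n) (allFin n)

∑-pairs-1 : (n : ℕ) → ∑ (λ _ → 1) (pairs n) ≡ n * n
∑-pairs-1 n = begin
  ∑ (λ _ → 1) (pairs n)                        ≡⟨ ∑-cartesianProduct _ (allFin n) (allFin n) ⟩
  ∑ (λ _ → ∑ (λ _ → 1) (allFin n)) (allFin n)  ≡⟨ ∑-cong (λ _ → ∑-allFin-1 n) (allFin n) ⟩
  ∑ (λ _ → n) (allFin n)                       ≡⟨ ∑-const n (allFin n) ⟩
  length (allFin n) * n                        ≡⟨ cong (_* n) (length-tabulate {n = n} (λ i → i)) ⟩
  n * n                                        ∎
  where open ≡-Reasoning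

length-outcomes : (n d : ℕ) → length (outcomes n d) ≡ size n d
length-outcomes n d = begin
  length (outcomes n d)           ≡⟨ *-identityʳ _ ⟨
  length (outcomes n d) * 1       ≡⟨ ∑-const 1 (outcomes n d) ⟨
  ∑ (λ _ → 1) (outcomes n d)      ≡⟨ ∑-allVecs-product (pairs n) (λ _ → 1) (λ _ → 1) refl (λ _ _ → refl) d ⟩
  ∑ (λ _ → 1) (pairs n) ^ d       ≡⟨ cong (_^ d) (∑-pairs-1 n) ⟩
  size n d                        ∎
  where open ≡-Reasoning

allPairs : {n : ℕ} → (Fin n → Fin n → Bool) → Bool
allPairs {n} p = allL (λ u → allL (p u) (allFin n)) (allFin n)

module _ {A : Set} where

  allL-cong : {f g : A → Bool} → (∀ x → f x ≡ g x) → (xs : List A) → allL f xs ≡ allL g xs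
  allL-cong f≗g []       = refl
  allL-cong f≗g (x ∷ xs) = cong₂ _∧_ (f≗g x) (allL-cong f≗g xs)

  allL-∧ : (f g : A → Bool) (xs : List A) → allL (λ x → f x ∧ g x) xs ≡ allL f xs ∧ allL g xs
  allL-∧ f g []       = refl
  allL-∧ f g (x ∷ xs) = trans (cong ((f x ∧ g x) ∧_) (allL-∧ f g xs)) (∧-interchange (f x) (g x) (allL f xs) (allL g xs))

  allL-true : {f : A → Bool} → (∀ x → f x ≡ true) → (xs : List A) → allL f xs ≡ true
  allL-true f≡true []       = refl
  allL-true f≡true (x ∷ xs) rewrite f≡true x = allL-true f≡true xs

  allL-false : {f : A → Bool} {x : A} {xs : List A} → x ∈ xs → f x ≡ false → allL f xs ≡ false
  allL-false {f} {xs = y ∷ ys} (here refl) fx≡false rewrite fx≡false = refl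
  allL-false {f} {xs = y ∷ ys} (there x∈ys) fx≡false = trans (cong (f y ∧_) (allL-false {f} x∈ys fx≡false)) (∧-zeroʳ (f y))

module _ {n : ℕ} where

  allPairs-cong : {p q : Fin n → Fin n → Bool} → (∀ u v → p u v ≡ q u v) → allPairs p ≡ allPairs q
  allPairs-cong p≗q = allL-cong (λ u → allL-cong (p≗q u) (allFin n)) (allFin n)

  allPairs-∧ : (p q : Fin n → Fin n → Bool) → allPairs (λ u v → p u v ∧ q u v) ≡ allPairs p ∧ allPairs q
  allPairs-∧ p q = trans (allL-cong (λ u → allL-∧ (p u) (q u) (allFin n)) (allFin n))
                         (allL-∧ (λ u → allL (p u) (allFin n)) (λ u → allL (q u) (allFin n)) (allFin n))

  allPairs-true : {p : Fin n → Fin n → Bool} → (∀ u v → p u v ≡ true) → allPairs p ≡ true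
  allPairs-true p≡true = allL-true (λ u → allL-true (p≡true u) (allFin n)) (allFin n)

  allPairs-false : {p : Fin n → Fin n → Bool} (u v : Fin n) → p u v ≡ false → allPairs p ≡ false
  allPairs-false u v puv≡false = allL-false (∈-allFin u) (allL-false (∈-allFin v) puv≡false)

conflict : {n m : ℕ} → Outcome n m → Subset n → Fin n → Fin n → Bool
conflict ω S u v = does (u ∈? S) ∧ does (v ∈? S) ∧ adj ω u v

-- A conflict in e ∷ ω comes from the edge e or from ω.
no-conflict-∷ : ∀ a b c d e →
                not (a ∧ b ∧ (c ∧ (d ∨ e))) ≡ not (a ∧ b ∧ (c ∧ (d ∨ false))) ∧ not (a ∧ b ∧ (c ∧ e))
no-conflict-∷ true  true  true  true  e = refl
no-conflict-∷ true  true  true  false e = refl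
no-conflict-∷ true  true  false d     e = refl
no-conflict-∷ true  false c     d     e = refl
no-conflict-∷ false b     c     d     e = refl

-- The empty edge sequence has no conflicts.
no-conflict-[] : ∀ a b c → not (a ∧ b ∧ (c ∧ false)) ≡ true
no-conflict-[] true  true  true  = refl
no-conflict-[] true  true  false = refl
no-conflict-[] true  false c     = refl
no-conflict-[] false b     c     = refl

module _ {n : ℕ} (S : Subset n) where

  independent-[] : independent [] S ≡ true
  independent-[] = allPairs-true (λ u v → no-conflict-[] (does (u ∈? S)) (does (v ∈? S)) (not (sameFin u v)))

  independent-∷ : ∀ {m} (e : Fin n × Fin n) (ω : Outcome n m) →
                  independent (e ∷ ω) S ≡ independent (e ∷ []) S ∧ independent ω S
  independent-∷ e ω = trans
    (allPairs-cong (λ u v → no-conflict-∷ (does (u ∈? S)) (does (v ∈? S)) (not (sameFin u v)) (isEdge u v e) (anyEdge u v ω)))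
    (allPairs-∧ (λ u v → not (conflict (e ∷ []) S u v)) (λ u v → not (conflict ω S u v)))

  independent-++ : ∀ {d m} (ω₂ : Outcome n d) (ω₁ : Outcome n m) →
                   independent (ω₂ ++ᵛ ω₁) S ≡ independent ω₂ S ∧ independent ω₁ S
  independent-++ []       ω₁ rewrite independent-[] = refl
  independent-++ (e ∷ ω₂) ω₁ = begin
    independent (e ∷ (ω₂ ++ᵛ ω₁)) S                      ≡⟨ independent-∷ e (ω₂ ++ᵛ ω₁) ⟩
    ind₁ ∧ independent (ω₂ ++ᵛ ω₁) S                     ≡⟨ cong (ind₁ ∧_) (independent-++ ω₂ ω₁) ⟩
    ind₁ ∧ (independent ω₂ S ∧ independent ω₁ S)         ≡⟨ ∧-assoc ind₁ _ _ ⟨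
    (ind₁ ∧ independent ω₂ S) ∧ independent ω₁ S         ≡⟨ cong (_∧ independent ω₁ S) (independent-∷ e ω₂) ⟨
    independent (e ∷ ω₂) S ∧ independent ω₁ S            ∎
    where
    open ≡-Reasoning
    ind₁ = independent (e ∷ []) S

inside : {n : ℕ} → Subset n → Fin n → Fin n → Bool
inside S a b = does (a ∈? S) ∧ does (b ∈? S) ∧ not (sameFin a b)

-- A single edge ab destroys the independence of S exactly when it lies inside S:
-- the only pairs it can make adjacent are (a,b) and (b,a).
module _ {n : ℕ} (S : Subset n) (a b : Fin n) where

  -- Elimination and introduction for T on conjunctions and decisions, with the
  -- Booleans given explicitly (T is not injective, so they cannot be inferred).
  private
    ∧-split : ∀ x {y} → T (x ∧ y) → T x × T y
    ∧-split true ty = _ , ty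

    ∧₄-split : ∀ x y z {w} → T (x ∧ y ∧ z ∧ w) → T x × T y × T z × T w
    ∧₄-split true true true tw = _ , _ , _ , tw

    ∧-pair : ∀ x {y} → T x → T y → T (x ∧ y)
    ∧-pair true _ ty = ty

    not-does⇒¬ : {A : Set} (d : Dec A) → T (not (does d)) → ¬ A
    not-does⇒¬ (no ¬p) _ = ¬p

    ¬⇒not-does : {A : Set} (d : Dec A) → ¬ A → T (not (does d))
    ¬⇒not-does (yes p) ¬p = ¬p p
    ¬⇒not-does (no _)  _  = _

  conflict-ab : conflict ((a , b) ∷ []) S a b ≡ inside S a b
  conflict-ab rewrite dec-true (a ≟ a) refl | dec-true (b ≟ b) refl | ∧-identityʳ (not (sameFin a b)) = refl

  -- A conflict at (u,v) means {u,v} = {a,b} with u ≠ v both in S.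
  conflict⇒inside : ∀ u v → T (conflict ((a , b) ∷ []) S u v) → T (inside S a b)
  conflict⇒inside u v t with ∧₄-split (does (u ∈? S)) (does (v ∈? S)) (not (sameFin u v)) t
  ... | tu , tv , u≢v , edge with Equivalence.to T-∨ edge
  ...   | inj₂ ()
  ...   | inj₁ uv∈ab with Equivalence.to T-∨ uv∈ab
  ...     | inj₁ same with (u≡a , v≡b) ← ∧-split (sameFin u a) same =
    subst₂ (λ x y → T (inside S x y)) (does⇒ (u ≟ a) u≡a) (does⇒ (v ≟ b) v≡b)
           (∧-pair (does (u ∈? S)) tu (∧-pair (does (v ∈? S)) tv u≢v))
  ...     | inj₂ swapped with (u≡b , v≡a) ← ∧-split (sameFin u b) swapped =
    subst₂ (λ x y → T (inside S x y)) (does⇒ (v ≟ a) v≡a) (does⇒ (u ≟ b) u≡b)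
           (∧-pair (does (v ∈? S)) tv (∧-pair (does (u ∈? S)) tu v≢u))
    where
    v≢u : T (not (sameFin v u))
    v≢u = ¬⇒not-does (v ≟ u) (λ v≡u → not-does⇒¬ (u ≟ v) u≢v (sym v≡u))

  independent-single : independent ((a , b) ∷ []) S ≡ not (inside S a b)
  independent-single with inside S a b in eq
  ... | true  = allPairs-false a b (cong not (trans conflict-ab eq))
  ... | false = allPairs-true no-conflict
    where
    no-conflict : ∀ u v → not (conflict ((a , b) ∷ []) S u v) ≡ true
    no-conflict u v with conflict ((a , b) ∷ []) S u v | conflict⇒inside u v
    ... | true  | ⇒inside = ⊥-elim (subst T eq (⇒inside _))
    ... | false | _       = refl

∑-∈ : {n : ℕ} (S : Subset n) → ∑ (λ b → 𝟙 (does (b ∈? S))) (allFin n) ≡ ∣ S ∣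
∑-∈ []          = refl
∑-∈ (true  ∷ S) = trans (∑-allFin-suc (λ b → 𝟙 (does (b ∈? (true ∷ S))))) (cong suc (∑-∈ S))
∑-∈ (false ∷ S) = trans (∑-allFin-suc (λ b → 𝟙 (does (b ∈? (false ∷ S))))) (∑-∈ S)

∑-others : {n : ℕ} (S : Subset n) (a : Fin n) →
           𝟙 (does (a ∈? S)) + ∑ (λ b → 𝟙 (does (b ∈? S) ∧ not (sameFin a b))) (allFin n) ≡ ∣ S ∣
∑-others {suc n} (s ∷ S) a = begin
  𝟙 (does (a ∈? (s ∷ S))) + ∑ f (allFin (suc n))
    ≡⟨ cong (𝟙 (does (a ∈? (s ∷ S))) +_) (∑-allFin-suc f) ⟩
  𝟙 (does (a ∈? (s ∷ S))) + (f zero + ∑ (f ∘ suc) (allFin n))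
    ≡⟨ x∙yz≈y∙xz (𝟙 (does (a ∈? (s ∷ S)))) (f zero) _ ⟩
  f zero + (𝟙 (does (a ∈? (s ∷ S))) + ∑ (f ∘ suc) (allFin n))
    ≡⟨ split s a ⟩
  𝟙 s + ∣ S ∣
    ≡⟨ ∣∷∣ s ⟩
  ∣ s ∷ S ∣ ∎
  where
  open ≡-Reasoning
  f : Fin (suc n) → ℕ
  f b = 𝟙 (does (b ∈? (s ∷ S)) ∧ not (sameFin a b))
  ∣∷∣ : ∀ s → 𝟙 s + ∣ S ∣ ≡ ∣ s ∷ S ∣
  ∣∷∣ true  = refl
  ∣∷∣ false = refl
  -- a = zero: zero is not its own partner and is counted by the indicator;
  -- a = suc a′: zero is a partner iff it lies in S, the rest is the same count for S.
  split : ∀ s a → 𝟙 (does (zero ∈? (s ∷ S)) ∧ not (sameFin a zero))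
                + (𝟙 (does (a ∈? (s ∷ S))) + ∑ (λ b → 𝟙 (does (b ∈? S) ∧ not (sameFin a (suc b)))) (allFin n))
              ≡ 𝟙 s + ∣ S ∣
  split true  zero    = cong suc (trans (∑-cong (λ b → cong 𝟙 (∧-identityʳ _)) (allFin n)) (∑-∈ S))
  split false zero    = trans (∑-cong (λ b → cong 𝟙 (∧-identityʳ _)) (allFin n)) (∑-∈ S)
  split true  (suc a) = cong suc (∑-others S a)
  split false (suc a) = ∑-others S a

survivors : {n : ℕ} → Subset n → ℕ
survivors {n} S = ∑ (λ e → 𝟙 (independent (e ∷ []) S)) (pairs n)

module _ {n : ℕ} (S : Subset n) where

  destroyers : ∑ (λ e → 𝟙 (not (independent (e ∷ []) S))) (pairs n) ≡ ∣ S ∣ * (∣ S ∣ ∸ 1)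
  destroyers = begin
    ∑ (λ e → 𝟙 (not (independent (e ∷ []) S))) (pairs n)
      ≡⟨ ∑-cartesianProduct _ (allFin n) (allFin n) ⟩
    ∑ (λ a → ∑ (λ b → 𝟙 (not (independent ((a , b) ∷ []) S))) (allFin n)) (allFin n)
      ≡⟨ ∑-cong (λ a → ∑-cong (destroys a) (allFin n)) (allFin n) ⟩
    ∑ (λ a → ∑ (λ b → 𝟙 (does (a ∈? S)) * 𝟙 (does (b ∈? S) ∧ not (sameFin a b))) (allFin n)) (allFin n)
      ≡⟨ ∑-cong (λ a → ∑-*ˡ (𝟙 (does (a ∈? S))) _ (allFin n)) (allFin n) ⟩
    ∑ (λ a → 𝟙 (does (a ∈? S)) * ∑ (λ b → 𝟙 (does (b ∈? S) ∧ not (sameFin a b))) (allFin n)) (allFin n)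
      ≡⟨ ∑-cong (λ a → partners (does (a ∈? S)) (∑-others S a)) (allFin n) ⟩
    ∑ (λ a → 𝟙 (does (a ∈? S)) * (∣ S ∣ ∸ 1)) (allFin n)
      ≡⟨ ∑-*ʳ (∣ S ∣ ∸ 1) _ (allFin n) ⟩
    ∑ (λ a → 𝟙 (does (a ∈? S))) (allFin n) * (∣ S ∣ ∸ 1)
      ≡⟨ cong (_* (∣ S ∣ ∸ 1)) (∑-∈ S) ⟩
    ∣ S ∣ * (∣ S ∣ ∸ 1) ∎
    where
    open ≡-Reasoning
    destroys : ∀ a b → 𝟙 (not (independent ((a , b) ∷ []) S))
                       ≡ 𝟙 (does (a ∈? S)) * 𝟙 (does (b ∈? S) ∧ not (sameFin a b))
    destroys a b = trans (cong 𝟙 (trans (cong not (independent-single S a b)) (not-involutive _))) (𝟙-∧ (does (a ∈? S)) _)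
    partners : ∀ x {y} → 𝟙 x + y ≡ ∣ S ∣ → 𝟙 x * y ≡ 𝟙 x * (∣ S ∣ ∸ 1)
    partners true  eq = cong (λ s → 1 * (s ∸ 1)) eq
    partners false eq = refl

  survivors-count : survivors S ≡ n * n ∸ ∣ S ∣ * (∣ S ∣ ∸ 1)
  survivors-count = begin
    survivors S                                ≡⟨ m+n∸n≡m (survivors S) destroyed ⟨
    survivors S + destroyed ∸ destroyed        ≡⟨ cong₂ _∸_ all-edges destroyers ⟩
    n * n ∸ ∣ S ∣ * (∣ S ∣ ∸ 1)                 ∎
    where
    open ≡-Reasoning
    destroyed : ℕ
    destroyed = ∑ (λ e → 𝟙 (not (independent (e ∷ []) S))) (pairs n)
    all-edges : survivors S + destroyed ≡ n * n
    all-edges = begin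
      survivors S + destroyed                                            ≡⟨ ∑-+ _ _ (pairs n) ⟨
      ∑ (λ e → 𝟙 (independent (e ∷ []) S) + 𝟙 (not (independent (e ∷ []) S))) (pairs n)
                                                                         ≡⟨ ∑-cong (λ e → 𝟙-not (independent (e ∷ []) S)) (pairs n) ⟩
      ∑ (λ _ → 1) (pairs n)                                              ≡⟨ ∑-pairs-1 n ⟩
      n * n                                                              ∎

independent-count : {n : ℕ} (S : Subset n) (d : ℕ) →
                    ∑ (λ ω → 𝟙 (independent ω S)) (outcomes n d) ≡ survivors S ^ d
independent-count S = ∑-allVecs-product _ _ (λ ω → 𝟙 (independent ω S))
  (cong 𝟙 (independent-[] S))
  (λ e ω → trans (cong 𝟙 (independent-∷ S e ω)) (𝟙-∧ (independent (e ∷ []) S) (independent ω S)))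

-- ρ(n,k) = n² − k(k−1): the number of values of one edge keeping a given k-set independent.
ρ : ℕ → ℕ → ℕ
ρ n k = n * n ∸ k * (k ∸ 1)

independentOfSize : {n m : ℕ} → ℕ → Outcome n m → Subset n → Bool
independentOfSize k ω S = (∣ S ∣ ≡ᵇ k) ∧ independent ω S

module _ (n k : ℕ) where

  extension-count : ∀ {m} d (ω₁ : Outcome n m) (S : Subset n) →
                    ∑ (λ ω₂ → 𝟙 (independentOfSize k (ω₂ ++ᵛ ω₁) S)) (outcomes n d)
                    ≡ 𝟙 (independentOfSize k ω₁ S) * ρ n k ^ d
  extension-count d ω₁ S = begin
    ∑ (λ ω₂ → 𝟙 (independentOfSize k (ω₂ ++ᵛ ω₁) S)) (outcomes n d)
      ≡⟨ ∑-cong (λ ω₂ → trans (cong (λ t → 𝟙 ((∣ S ∣ ≡ᵇ k) ∧ t)) (independent-++ S ω₂ ω₁))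
                              (split-∧ (∣ S ∣ ≡ᵇ k) (independent ω₂ S) (independent ω₁ S))) (outcomes n d) ⟩
    ∑ (λ ω₂ → χ * 𝟙 (independent ω₂ S)) (outcomes n d)
      ≡⟨ ∑-*ˡ χ (λ ω₂ → 𝟙 (independent ω₂ S)) (outcomes n d) ⟩
    χ * ∑ (λ ω₂ → 𝟙 (independent ω₂ S)) (outcomes n d)
      ≡⟨ cong (χ *_) (independent-count S d) ⟩
    χ * survivors S ^ d
      ≡⟨ survivors-k ⟩
    χ * ρ n k ^ d ∎
    where
    open ≡-Reasoning
    χ : ℕ
    χ = 𝟙 (independentOfSize k ω₁ S)
    split-∧ : ∀ c a b → 𝟙 (c ∧ (a ∧ b)) ≡ 𝟙 (c ∧ b) * 𝟙 a
    split-∧ true  a b = trans (𝟙-∧ a b) (*-comm (𝟙 a) (𝟙 b))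
    split-∧ false a b = refl
    survivors-k : χ * survivors S ^ d ≡ χ * ρ n k ^ d
    survivors-k with ∣ S ∣ ≡ᵇ k in eq
    ... | false = refl
    ... | true  = cong (λ t → 𝟙 (independent ω₁ S) * t ^ d)
                       (trans (survivors-count S) (cong (λ s → n * n ∸ s * (s ∸ 1)) (≡ᵇ⇒≡ ∣ S ∣ k (subst T (sym eq) _))))

  extension-sum : ∀ {m} d (ω₁ : Outcome n m) → ∑ (λ ω₂ → X k (ω₂ ++ᵛ ω₁)) (outcomes n d) ≡ X k ω₁ * ρ n k ^ d
  extension-sum d ω₁ = begin
    ∑ (λ ω₂ → X k (ω₂ ++ᵛ ω₁)) (outcomes n d)
      ≡⟨ ∑-cong (λ ω₂ → countB-∑ (independentOfSize k (ω₂ ++ᵛ ω₁)) (allSubsets n)) (outcomes n d) ⟩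
    ∑ (λ ω₂ → ∑ (λ S → 𝟙 (independentOfSize k (ω₂ ++ᵛ ω₁) S)) (allSubsets n)) (outcomes n d)
      ≡⟨ ∑-swap _ (outcomes n d) (allSubsets n) ⟩
    ∑ (λ S → ∑ (λ ω₂ → 𝟙 (independentOfSize k (ω₂ ++ᵛ ω₁) S)) (outcomes n d)) (allSubsets n)
      ≡⟨ ∑-cong (extension-count d ω₁) (allSubsets n) ⟩
    ∑ (λ S → 𝟙 (independentOfSize k ω₁ S) * ρ n k ^ d) (allSubsets n)
      ≡⟨ ∑-*ʳ _ _ (allSubsets n) ⟩
    ∑ (λ S → 𝟙 (independentOfSize k ω₁ S)) (allSubsets n) * ρ n k ^ d
      ≡⟨ cong (_* ρ n k ^ d) (countB-∑ (independentOfSize k ω₁) (allSubsets n)) ⟨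
    X k ω₁ * ρ n k ^ d ∎
    where open ≡-Reasoning

  total-step : ∀ d m → ∑ (X k) (outcomes n (d + m)) ≡ ∑ (X k) (outcomes n m) * ρ n k ^ d
  total-step d m = begin
    ∑ (X k) (outcomes n (d + m))                                          ≡⟨ ∑-allVecs-++ (pairs n) d m (X k) ⟩
    ∑ (λ ω₂ → ∑ (λ ω₁ → X k (ω₂ ++ᵛ ω₁)) (outcomes n m)) (outcomes n d)   ≡⟨ ∑-swap _ (outcomes n d) (outcomes n m) ⟩
    ∑ (λ ω₁ → ∑ (λ ω₂ → X k (ω₂ ++ᵛ ω₁)) (outcomes n d)) (outcomes n m)   ≡⟨ ∑-cong (extension-sum d) (outcomes n m) ⟩
    ∑ (λ ω₁ → X k ω₁ * ρ n k ^ d) (outcomes n m)                          ≡⟨ ∑-*ʳ _ (X k) (outcomes n m) ⟩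
    ∑ (X k) (outcomes n m) * ρ n k ^ d                                    ∎
    where open ≡-Reasoning

  positive : ∀ {m} → Outcome n m → Bool
  positive ω = not (X k ω ≡ᵇ 0)

  positiveExtensions : ∀ {m} d → Outcome n m → ℕ
  positiveExtensions d ω₁ = ∑ (λ ω₂ → 𝟙 (positive (ω₂ ++ᵛ ω₁))) (outcomes n d)

  positive-split : ∀ d m → ∑ (𝟙 ∘ positive) (outcomes n (d + m)) ≡ ∑ (positiveExtensions d) (outcomes n m)
  positive-split d m = trans (∑-allVecs-++ (pairs n) d m (𝟙 ∘ positive)) (∑-swap _ (outcomes n d) (outcomes n m))

  positiveExtensions-markov : ∀ {m} d (ω₁ : Outcome n m) → positiveExtensions d ω₁ ≤ X k ω₁ * ρ n k ^ d
  positiveExtensions-markov d ω₁ =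
    ≤-trans (∑-mono (λ ω₂ → 𝟙-positive≤ (X k (ω₂ ++ᵛ ω₁))) (outcomes n d)) (≤-reflexive (extension-sum d ω₁))
    where
    𝟙-positive≤ : ∀ x → 𝟙 (not (x ≡ᵇ 0)) ≤ x
    𝟙-positive≤ zero    = z≤n
    𝟙-positive≤ (suc x) = s≤s z≤n

  positiveExtensions-≤ : ∀ {m} d (ω₁ : Outcome n m) → positiveExtensions d ω₁ ≤ size n d
  positiveExtensions-≤ d ω₁ = begin
    positiveExtensions d ω₁        ≤⟨ ∑-mono (λ ω₂ → 𝟙≤1 (positive (ω₂ ++ᵛ ω₁))) (outcomes n d) ⟩
    ∑ (λ _ → 1) (outcomes n d)     ≡⟨ ∑-const 1 (outcomes n d) ⟩
    length (outcomes n d) * 1      ≡⟨ *-identityʳ _ ⟩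
    length (outcomes n d)          ≡⟨ length-outcomes n d ⟩
    size n d                       ∎
    where
    open ≤-Reasoning
    𝟙≤1 : ∀ x → 𝟙 x ≤ 1
    𝟙≤1 true  = s≤s z≤n
    𝟙≤1 false = z≤n

  positive-vs-below : ∀ d m (below : Outcome n m → Bool) →
    (∀ ω₁ → T (below ω₁) → 2 * (X k ω₁ * ρ n k ^ d) < size n d) →
    2 * ∑ (𝟙 ∘ positive) (outcomes n (d + m)) + size n d * ∑ (𝟙 ∘ below) (outcomes n m) ≤ size n m * (2 * size n d)
  positive-vs-below d m below small =
    subst₂ (λ P μ → 2 * P + size n d * ∑ (𝟙 ∘ below) (outcomes n m) ≤ μ * (2 * size n d))
           (sym (positive-split d m)) (length-outcomes n m)
           (averaging (size n d) (positiveExtensions d) below (positiveExtensions-≤ d)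
                      (λ ω₁ t → ≤-<-trans (*-monoʳ-≤ 2 (positiveExtensions-markov d ω₁)) (small ω₁ t))
                      (outcomes n m))

-- Arithmetic of nonnegative fractions (ℤ.+ a)/b in ℚ, reduced to ℕ through the
-- unnormalised rationals: the normalised fraction a/b is a/b as an unnormalised rational.
toℚᵘ-/ : ∀ a b .{{_ : NonZero b}} → ℚ.toℚᵘ ((ℤ.+ a) / b) ℚᵘ.≃ mkℚᵘ (ℤ.+ a) (pred b)
toℚᵘ-/ a (suc b) = ℚP.toℚᵘ-fromℚᵘ (mkℚᵘ (ℤ.+ a) b)

/-<⇒*-< : ∀ a b c d .{{_ : NonZero b}} .{{_ : NonZero d}} → (ℤ.+ a) / b ℚ.< (ℤ.+ c) / d → a * d < c * b
/-<⇒*-< a b@(suc _) c d@(suc _) lt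
  with ℚᵘP.<-respʳ-≃ (toℚᵘ-/ c d) (ℚᵘP.<-respˡ-≃ (toℚᵘ-/ a b) (ℚP.toℚᵘ-mono-< lt))
... | *<* ad<cb = ℤP.drop‿+<+ (subst₂ ℤ._<_ (sym (ℤP.pos-* a d)) (sym (ℤP.pos-* c b)) ad<cb)

*-≤⇒/-≤ : ∀ a b c d .{{_ : NonZero b}} .{{_ : NonZero d}} → a * d ≤ c * b → (ℤ.+ a) / b ℚ.≤ (ℤ.+ c) / d
*-≤⇒/-≤ a b@(suc _) c d@(suc _) ad≤cb =
  ℚP.toℚᵘ-cancel-≤ (ℚᵘP.≤-respʳ-≃ (ℚᵘP.≃-sym (toℚᵘ-/ c d)) (ℚᵘP.≤-respˡ-≃ (ℚᵘP.≃-sym (toℚᵘ-/ a b))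
    (*≤* (subst₂ ℤ._≤_ (ℤP.pos-* a d) (ℤP.pos-* c b) (ℤ.+≤+ ad≤cb)))))

/-* : ∀ a b c d .{{_ : NonZero b}} .{{_ : NonZero d}} →
      ((ℤ.+ a) / b) ℚ.* ((ℤ.+ c) / d) ≡ _/_ (ℤ.+ (a * c)) (b * d) {{m*n≢0 b d}}
/-* a b@(suc _) c d@(suc _) = ℚP.toℚᵘ-injective (ℚᵘP.≃-trans (ℚP.toℚᵘ-homo-* ((ℤ.+ a) / b) ((ℤ.+ c) / d))
  (ℚᵘP.≃-trans (ℚᵘP.*-cong (toℚᵘ-/ a b) (toℚᵘ-/ c d))
  (ℚᵘP.≃-trans (ℚᵘP.≃-reflexive (cong (λ z → mkℚᵘ z (pred (b * d))) (sym (ℤP.pos-* a c))))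
  (ℚᵘP.≃-sym (toℚᵘ-/ (a * c) (b * d) {{m*n≢0 b d}})))))

/-+ : ∀ a b c d .{{_ : NonZero b}} .{{_ : NonZero d}} →
      ((ℤ.+ a) / b) ℚ.+ ((ℤ.+ c) / d) ≡ _/_ (ℤ.+ (a * d + c * b)) (b * d) {{m*n≢0 b d}}
/-+ a b@(suc _) c d@(suc _) = ℚP.toℚᵘ-injective (ℚᵘP.≃-trans (ℚP.toℚᵘ-homo-+ ((ℤ.+ a) / b) ((ℤ.+ c) / d))
  (ℚᵘP.≃-trans (ℚᵘP.+-cong (toℚᵘ-/ a b) (toℚᵘ-/ c d))
  (ℚᵘP.≃-trans (ℚᵘP.≃-reflexive (cong (λ z → mkℚᵘ z (pred (b * d))) numerator))
  (ℚᵘP.≃-sym (toℚᵘ-/ (a * d + c * b) (b * d) {{m*n≢0 b d}})))))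
  where
  numerator : (ℤ.+ a) ℤ.* (ℤ.+ d) ℤ.+ (ℤ.+ c) ℤ.* (ℤ.+ b) ≡ ℤ.+ (a * d + c * b)
  numerator = trans (cong₂ ℤ._+_ (sym (ℤP.pos-* a d)) (sym (ℤP.pos-* c b))) (sym (ℤP.pos-+ (a * d) (c * b)))

two : ℚ
two = (ℤ.+ 2) / 1

-- The per-outcome step: writing E_m = T/μ and E_{d+m} = T·r/(D·μ), an outcome with
-- h·x < E_m, where 2·E_{d+m} < h, satisfies 2·x·r < D.
below⇒sparse : ∀ (h : ℚ) (x T r D μ : ℕ) .{{_ : NonZero D}} .{{_ : NonZero μ}} →
               h ℚ.* ((ℤ.+ x) / 1) ℚ.< (ℤ.+ T) / μ →
               two ℚ.* (_/_ (ℤ.+ (T * r)) (D * μ) {{m*n≢0 D μ}}) ℚ.< h →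
               2 * (x * r) < D
-- For x > 0: 2E′·x < h·x < E; cross-multiplying and cancelling T·μ leaves 2xr < D.
below⇒sparse h zero      T r D μ _     _      = >-nonZero⁻¹ D
below⇒sparse h x@(suc _) T r D μ hx<E 2E′<h =
  *-cancelʳ-< (T * μ) (2 * (x * r)) D (subst₂ _<_
    (solve 4 (λ x T r μ → con 2 :* (T :* r) :* x :* μ := con 2 :* (x :* r) :* (T :* μ)) refl x T r μ)
    (solve 3 (λ T D μ → T :* ((con 1 :* (D :* μ)) :* con 1) := D :* (T :* μ)) refl T D μ)
    cross)
  where
  open +-*-Solver using (solve; _:*_; _:=_; con)
  instance
    _ : NonZero (D * μ)
    _ = m*n≢0 D μ
    _ : NonZero (1 * (D * μ))
    _ = m*n≢0 1 (D * μ)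
    _ : NonZero (1 * (D * μ) * 1)
    _ = m*n≢0 (1 * (D * μ)) 1
  E′ : ℚ
  E′ = (ℤ.+ (T * r)) / (D * μ)
  2E′x<E : (two ℚ.* E′) ℚ.* ((ℤ.+ x) / 1) ℚ.< (ℤ.+ T) / μ
  2E′x<E = ℚP.<-trans (ℚP.*-monoˡ-<-pos ((ℤ.+ x) / 1) {{ℚP.normalize-pos x 1}} 2E′<h) hx<E
  2E′x≡ : (two ℚ.* E′) ℚ.* ((ℤ.+ x) / 1) ≡ (ℤ.+ (2 * (T * r) * x)) / (1 * (D * μ) * 1)
  2E′x≡ = trans (cong (ℚ._* ((ℤ.+ x) / 1)) (/-* 2 1 (T * r) (D * μ))) (/-* (2 * (T * r)) (1 * (D * μ)) x 1)
  cross : 2 * (T * r) * x * μ < T * (1 * (D * μ) * 1)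
  cross = /-<⇒*-< (2 * (T * r) * x) (1 * (D * μ) * 1) T μ (subst (ℚ._< (ℤ.+ T) / μ) 2E′x≡ 2E′x<E)

-- The final step: if 1 − q ≤ P/(D·μ) and 2P + D·A ≤ μ·2D, then A/μ ≤ 2q.
-- With p = P/(D·μ) and a = A/μ the count says 2p + a ≤ 2, so a ≤ 2 − 2p ≤ 2q.
counts⇒bound : ∀ (q : ℚ) (P A D μ : ℕ) .{{_ : NonZero D}} .{{_ : NonZero μ}} →
               1ℚ ℚ.- q ℚ.≤ _/_ (ℤ.+ P) (D * μ) {{m*n≢0 D μ}} →
               2 * P + D * A ≤ μ * (2 * D) →
               (ℤ.+ A) / μ ℚ.≤ two ℚ.* q
counts⇒bound q P A D μ 1-q≤p counts = begin
  a                                  ≡⟨ add-sub two p a ⟩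
  (two ℚ.* p ℚ.+ a) ℚ.- two ℚ.* p    ≤⟨ ℚP.+-monoˡ-≤ (ℚ.- (two ℚ.* p)) 2p+a≤2 ⟩
  two ℚ.- two ℚ.* p                  ≤⟨ ℚP.+-monoʳ-≤ two (ℚP.neg-antimono-≤ (ℚP.*-monoˡ-≤-nonNeg two 1-q≤p)) ⟩
  two ℚ.- two ℚ.* (1ℚ ℚ.- q)         ≡⟨ sub-complement two q ⟩
  two ℚ.* q                          ∎
  where
  open ℚP.≤-Reasoning
  add-sub : ∀ t p a → a ≡ (t ℚ.* p ℚ.+ a) ℚ.- t ℚ.* p
  add-sub = solve 3 (λ t p a → a := (t :* p :+ a) :- t :* p) refl
    where open ℚ-Solver using (solve; _:*_; _:+_; _:-_; _:=_)
  sub-complement : ∀ t q → t ℚ.- t ℚ.* (1ℚ ℚ.- q) ≡ t ℚ.* q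
  sub-complement = solve 2 (λ t q → t :- t :* (con 1ℚ :- q) := t :* q) refl
    where open ℚ-Solver using (solve; _:*_; _:-_; _:=_; con)
  instance
    _ : NonZero (D * μ)
    _ = m*n≢0 D μ
    _ : NonZero (1 * (D * μ))
    _ = m*n≢0 1 (D * μ)
  p a : ℚ
  p = (ℤ.+ P) / (D * μ)
  a = (ℤ.+ A) / μ
  cross : (2 * P * μ + A * (1 * (D * μ))) * 1 ≤ 2 * ((1 * (D * μ)) * μ)
  cross = subst₂ _≤_
    (solve 4 (λ P A D μ → (con 2 :* P :+ D :* A) :* μ := (con 2 :* P :* μ :+ A :* (con 1 :* (D :* μ))) :* con 1) refl P A D μ)
    (solve 2 (λ D μ → μ :* (con 2 :* D) :* μ := con 2 :* ((con 1 :* (D :* μ)) :* μ)) refl D μ)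
    (*-monoˡ-≤ μ counts)
    where open +-*-Solver using (solve; _:*_; _:+_; _:=_; con)
  2p+a≤2 : two ℚ.* p ℚ.+ a ℚ.≤ two
  2p+a≤2 = subst (ℚ._≤ two) (sym (trans (cong (ℚ._+ a) (/-* 2 1 P (D * μ))) (/-+ (2 * P) (1 * (D * μ)) A μ)))
                 (*-≤⇒/-≤ (2 * P * μ + A * (1 * (D * μ))) ((1 * (D * μ)) * μ) 2 1 {{m*n≢0 _ μ}} cross)

module _ (n : ℕ) .{{_ : NonZero n}} where

  Pr-∑ : ∀ m .{{_ : NonZero (size n m)}} (P : Outcome n m → Bool) →
         Pr n m P ≡ (ℤ.+ ∑ (𝟙 ∘ P) (outcomes n m)) / size n m
  Pr-∑ m P = ℚP./-cong (cong ℤ.+_ (countB-∑ P (outcomes n m))) refl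

  E-∑ : ∀ m .{{_ : NonZero (size n m)}} k → E n m k ≡ (ℤ.+ ∑ (X k) (outcomes n m)) / size n m
  E-∑ m k = ℚP./-cong (cong ℤ.+_ (sum-map-∑ (X k) (outcomes n m))) refl

  /-size-split : ∀ d m .{{_ : NonZero (size n (d + m))}} .{{_ : NonZero (size n d * size n m)}} x →
                 (ℤ.+ x) / size n (d + m) ≡ (ℤ.+ x) / (size n d * size n m)
  /-size-split d m x = ℚP./-cong {ℤ.+ x} refl (^-distribˡ-+-* (n * n) d m)

  lemma5-split : (k : ℕ) (q h : ℚ) (d m : ℕ) →
                 1ℚ ℚ.- q ℚ.≤ PrPos n (d + m) k → two ℚ.* E n (d + m) k ℚ.< h →
                 PrBelow n m k h ℚ.≤ two ℚ.* q
  lemma5-split k q h d m 1-q≤PrPos 2E<h =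
    subst (ℚ._≤ two ℚ.* q) (sym (Pr-∑ m below))
          (counts⇒bound q positives (∑ (𝟙 ∘ below) (outcomes n m)) (size n d) (size n m)
                        (subst (1ℚ ℚ.- q ℚ.≤_) (trans (Pr-∑ (d + m) (positive n k)) (/-size-split d m positives))
                               1-q≤PrPos)
                        (positive-vs-below n k d m below sparse))
    where
    instance
      _ : NonZero (size n d)
      _ = m^n≢0 (n * n) d {{m*n≢0 n n}}
      _ : NonZero (size n m)
      _ = m^n≢0 (n * n) m {{m*n≢0 n n}}
      _ : NonZero (size n (d + m))
      _ = m^n≢0 (n * n) (d + m) {{m*n≢0 n n}}
      _ : NonZero (size n d * size n m)
      _ = m*n≢0 (size n d) (size n m)
    positives total : ℕ
    positives = ∑ (𝟙 ∘ positive n k) (outcomes n (d + m))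
    total = ∑ (X k) (outcomes n m)
    below : Outcome n m → Bool
    below ω = does (h ℚ.* ((ℤ.+ X k ω) / 1) ℚP.<? E n m k)
    E′≡ : E n (d + m) k ≡ (ℤ.+ (total * ρ n k ^ d)) / (size n d * size n m)
    E′≡ = trans (E-∑ (d + m) k) (trans (cong (λ t → (ℤ.+ t) / size n (d + m)) (total-step n k d m))
                                       (/-size-split d m (total * ρ n k ^ d)))
    sparse : ∀ ω₁ → T (below ω₁) → 2 * (X k ω₁ * ρ n k ^ d) < size n d
    sparse ω₁ t = below⇒sparse h (X k ω₁) total (ρ n k ^ d) (size n d) (size n m)
                    (subst (h ℚ.* ((ℤ.+ X k ω₁) / 1) ℚ.<_) (E-∑ m k)
                           (does⇒ (h ℚ.* ((ℤ.+ X k ω₁) / 1) ℚP.<? E n m k) t))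
                    (subst (λ e → two ℚ.* e ℚ.< h) E′≡ 2E<h)

-- Only the first half of IsM (Pr[X_{n,M}(k) > 0] ≥ 1 − q) is needed.
lemma5 : (n : ℕ) .{{_ : NonZero n}} (k : ℕ) (q h : ℚ) (M m : ℕ) →
         0 < k → 0ℚ ℚ.≤ q → q ℚ.≤ 1ℚ → IsM n k q M → m < M →
         (((ℤ.+ 2) / 1) ℚ.* E n M k) ℚ.< h → PrBelow n m k h ℚ.≤ ((ℤ.+ 2) / 1) ℚ.* q
lemma5 n k q h M m _ _ _ (1-q≤PrPos , _) m<M 2E<h =
  lemma5-split n k q h (M ∸ m) m (subst (λ M → 1ℚ ℚ.- q ℚ.≤ PrPos n M k) (sym M≡) 1-q≤PrPos)
                                 (subst (λ M → two ℚ.* E n M k ℚ.< h) (sym M≡) 2E<h)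
  where
  M≡ : M ∸ m + m ≡ M
  M≡ = m∸n+n≡m (<⇒≤ m<M)
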